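{- If $q$ is an odd prime power then $f(X):= X^{q+2}+bX^q+cX$ does not permute $\mathbb{F}_{q^2}$ for any $b,c\in\mathbb{F}_{q^2}$ with $b\ne 0$. -}

module Defs where

open import Level using (Level; _⊔_)
open import Data.Nat using (ℕ; _≤_; _^_)
open import Data.Nat.Primality using (Prime)
open import Data.Fin using (Fin)
open import Data.Product using (∃; _×_; ∃-syntax)
open import Relation.Nullary using (¬_)
open import Relation.Binary.PropositionalEquality using (_≡_)
import Relation.Binary.PropositionalEquality as ≡
open import Algebra.Bundles using (CommutativeRing)
import Algebra.Bundles
open import Function.Bundles using (Inverse)
open import Function.Definitions using (Bijective)
import Algebra.Definitions.RawSemiring as RS

IsPrimePower : ℕ → Set
IsPrimePower q = ∃[ p ] ∃[ k ] (Prime p × 1 ≤ k × q ≡ p ^ k)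

record IsField {c ℓ : Level} (R : CommutativeRing c ℓ) : Set (c ⊔ ℓ) where
  open CommutativeRing R
  field
    0≉1     : ¬ (0# ≈ 1#)
    inverse : ∀ x → ¬ (x ≈ 0#) → ∃[ y ] (x * y ≈ 1#)

HasCard : {c ℓ : Level} → CommutativeRing c ℓ → ℕ → Set (c ⊔ ℓ)
HasCard R n = Inverse (≡.setoid (Fin n)) (CommutativeRing.setoid R)

fPoly : {c ℓ : Level} (R : CommutativeRing c ℓ) → ℕ →
        CommutativeRing.Carrier R → CommutativeRing.Carrier R →
        CommutativeRing.Carrier R → CommutativeRing.Carrier R
fPoly R q b c x = (x ^ᴿ (q Data.Nat.+ 2)) + (b * (x ^ᴿ q)) + (c * x)
  where
  open CommutativeRing R
  open RS (Algebra.Bundles.Semiring.rawSemiring semiring) using () renaming (_^_ to _^ᴿ_)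
  import Data.Nat

Permutes : {c ℓ : Level} (R : CommutativeRing c ℓ) →
           (CommutativeRing.Carrier R → CommutativeRing.Carrier R) → Set (c ⊔ ℓ)
Permutes R f = Bijective _≈_ _≈_ f
  where open CommutativeRing R

-- Write q = 2m + 1, w = q − 1 = 2m and N = q² − 1, so that F has N + 1 elements.  The power
-- sums ∑ₓ xᵉ vanish for 0 ≤ e < N (multiply by aᵉ ≠ 1 and substitute x ↦ a x), while
-- ∑ₓ x^N = −1.  If f permutes F, then ∑ₓ f(x)^w = ∑ₓ x^w = 0.  On the other hand
-- f(x)^w = x^w (x^w (x² + b) + c)^w, and two binomial expansions turn ∑ₓ f(x)^w into a
-- combination of power sums in which the only exponent divisible by N is N itself, reached
-- once, with coefficient C(w, m) bᵐ.  So ∑ₓ f(x)^w = −C(w, m) bᵐ = −(−1)ᵐ bᵐ ≠ 0, because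
-- C(q − 1, j) ≡ (−1)ʲ modulo the characteristic p of F.
module Submission where

open import Defs
open import Level using (Level)
open import Algebra.Bundles using (Monoid; CommutativeMonoid; CommutativeSemiring; Ring; CommutativeRing)
open import Data.Nat as ℕ using (ℕ; zero; suc; _<_; _≤_; _∸_; z<s; s<s)
import Data.Nat.Properties as ℕ
open import Data.Nat.Divisibility using (_∣_; divides)
open import Data.Nat.Primality using (Prime)
open import Data.Nat.Combinatorics using (_C_; nCn≡1; nCk+nC[k+1]≡[n+1]C[k+1])
open import Data.Fin as Fin using (Fin; toℕ; punchIn)
open import Data.Fin.Properties using (suc-injective; 0≢1+n; punchInᵢ≢i; punchIn-injective; ¬∀⟶∃¬; inject≤-injective)
open import Data.Fin.Permutation using (Permutation)
open import Data.Vec using (Vec; []; _∷_; replicate)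
open import Data.Product using (∃-syntax; Σ-syntax; _,_; proj₁; proj₂)
open import Function using (_∘_; id; Inverse)
open import Function.Bundles using (Bijection)
open import Function.Definitions using (Congruent; Injective)
open import Function.Properties.Bijection using (Bijection⇒Inverse)
import Function.Construct.Composition as Composition
import Function.Construct.Symmetry as Symmetry
open import Relation.Nullary using (¬_; contradiction; yes; no)
open import Relation.Nullary.Decidable using (map′; decidable-stable)
open import Relation.Binary.Definitions using (Decidable; tri<; tri≈; tri>)
open import Relation.Binary.PropositionalEquality as ≡ using (_≡_; _≢_)
import Algebra.Properties.CommutativeMonoid.Sum as Sum

module Arithmetic where
  open import Data.Nat
  open import Data.Nat.Properties
  open import Data.Nat.Divisibility
  open import Data.Nat.Primality
  open import Data.Nat.Combinatorics
  open import Data.Nat.Tactic.RingSolver using (solve-∀)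
  open import Data.Sum using (inj₁; inj₂)
  open import Relation.Binary.PropositionalEquality

  [k+1]*[n+1]C[k+1]≡[n+1]*nCk : ∀ n k → suc k * (suc n C suc k) ≡ suc n * (n C k)
  [k+1]*[n+1]C[k+1]≡[n+1]*nCk zero    zero    = refl
  [k+1]*[n+1]C[k+1]≡[n+1]*nCk zero    (suc k) rewrite k>n⇒nCk≡0 {1} {suc (suc k)} (s≤s (s≤s z≤n))
                                                | k>n⇒nCk≡0 {0} {suc k} (s≤s z≤n) = *-zeroʳ (suc (suc k))
  [k+1]*[n+1]C[k+1]≡[n+1]*nCk (suc n) zero    = trans (+-identityʳ _) (trans (nC1≡n (suc (suc n))) (sym (*-identityʳ _)))
  [k+1]*[n+1]C[k+1]≡[n+1]*nCk (suc n) (suc k) = begin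
    suc (suc k) * (suc (suc n) C suc (suc k))  ≡⟨ cong (suc (suc k) *_) (nCk+nC[k+1]≡[n+1]C[k+1] (suc n) (suc k)) ⟨
    suc (suc k) * (a + b)                      ≡⟨ *-distribˡ-+ (suc (suc k)) a b ⟩
    a + suc k * a + suc (suc k) * b            ≡⟨ cong₂ (λ u v → a + u + v) ([k+1]*[n+1]C[k+1]≡[n+1]*nCk n k)
                                                                      ([k+1]*[n+1]C[k+1]≡[n+1]*nCk n (suc k)) ⟩
    a + suc n * (n C k) + suc n * (n C suc k)  ≡⟨ +-assoc a (suc n * (n C k)) (suc n * (n C suc k)) ⟩
    a + (suc n * (n C k) + suc n * (n C suc k)) ≡⟨ cong (a +_) (*-distribˡ-+ (suc n) (n C k) (n C suc k)) ⟨
    a + suc n * (n C k + n C suc k)            ≡⟨ cong (λ u → a + suc n * u) (nCk+nC[k+1]≡[n+1]C[k+1] n k) ⟩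
    suc (suc n) * a                            ∎
    where
    open ≡-Reasoning
    a = suc n C suc k
    b = suc n C suc (suc k)

  p^k∣m*n⇒p^k∤m⇒p∣n : ∀ {p} → Prime p → ∀ k {m n} → p ^ k ∣ m * n → ¬ (p ^ k ∣ m) → p ∣ n
  p^k∣m*n⇒p^k∤m⇒p∣n p-prime zero    {m} _ p^k∤m = contradiction (1∣ m) p^k∤m
  p^k∣m*n⇒p^k∤m⇒p∣n {p} p-prime (suc k) {m} {n} p^[1+k]∣mn p^[1+k]∤m
    with euclidsLemma m n p-prime (∣-trans (m∣m*n (p ^ k)) p^[1+k]∣mn)
  ... | inj₂ p∣n = p∣n
  ... | inj₁ (divides m′ refl) = p^k∣m*n⇒p^k∤m⇒p∣n p-prime k p^k∣m′n p^k∤m′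
    where
    instance _ = prime⇒nonZero p-prime
    p^k∣m′n : p ^ k ∣ m′ * n
    p^k∣m′n = *-cancelˡ-∣ p (subst (p * p ^ k ∣_) (trans (cong (_* n) (*-comm m′ p)) (*-assoc p m′ n)) p^[1+k]∣mn)
    p^k∤m′ : ¬ (p ^ k ∣ m′)
    p^k∤m′ p^k∣m′ = p^[1+k]∤m (subst (p * p ^ k ∣_) (*-comm p m′) (*-monoʳ-∣ p p^k∣m′))

  p∣p^kC[1+j] : ∀ {p k q j} → Prime p → q ≡ p ^ k → suc j < q → p ∣ q C suc j
  p∣p^kC[1+j] {p} {k} {suc r} {j} p-prime q≡p^k 1+j<q =
    p^k∣m*n⇒p^k∤m⇒p∣n p-prime k p^k∣[1+j]*qC[1+j] p^k∤1+j
    where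
    p^k∣[1+j]*qC[1+j] : p ^ k ∣ suc j * (suc r C suc j)
    p^k∣[1+j]*qC[1+j] = subst₂ _∣_ q≡p^k (sym ([k+1]*[n+1]C[k+1]≡[n+1]*nCk r j)) (m∣m*n (r C j))
    p^k∤1+j : ¬ (p ^ k ∣ suc j)
    p^k∤1+j p^k∣1+j = <⇒≱ 1+j<q (subst (_≤ suc j) (sym q≡p^k) (∣⇒≤ p^k∣1+j))

  ¬2∣⇒≡1+m+m : ∀ n → ¬ (2 ∣ n) → ∃[ m ] n ≡ suc (m + m)
  ¬2∣⇒≡1+m+m zero          2∤n = contradiction (divides 0 refl) 2∤n
  ¬2∣⇒≡1+m+m (suc zero)    _   = 0 , refl
  ¬2∣⇒≡1+m+m (suc (suc n)) 2∤n with ¬2∣⇒≡1+m+m n (2∤n ∘ ∣m∣n⇒∣m+n (∣-refl {2}))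
  ... | m , refl = suc m , cong (suc ∘ suc) (sym (+-suc m m))

  -- Exponents of x in the expansion of ∑ₓ f(x)^w, where w + w (w + 1) = q² − 1 for q = w + 1.
  outer-exponent<N : ∀ {w s i} → s < w → i ≤ s → w + w * s + 2 * i < w + w * suc w
  outer-exponent<N {i = i} s<w i≤s with m≤n⇒∃[o]m+o≡n s<w | m≤n⇒∃[o]m+o≡n i≤s
  ... | d , refl | t , refl = subst (w + w * (i + t) + 2 * i <_) (gap i t d) (m<m+n _ 0<1+n)
    where
    w = suc (i + t + d)
    gap : ∀ i t d → suc (i + t + d) + suc (i + t + d) * (i + t) + 2 * i + suc (suc (2 * t + 2 * d + suc (i + t + d) * d))
                    ≡ suc (i + t + d) + suc (i + t + d) * suc (suc (i + t + d))
    gap = solve-∀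

  top-exponent≡N : ∀ m → (m + m) + (m + m) * (m + m) + 2 * m ≡ (m + m) + (m + m) * suc (m + m)
  top-exponent≡N = solve-∀

  top-exponent<N : ∀ {m i} → i < m → (m + m) + (m + m) * (m + m) + 2 * i < (m + m) + (m + m) * suc (m + m)
  top-exponent<N {m} {i} i<m = subst (e + 2 * i <_) (top-exponent≡N m) (+-monoʳ-< e (*-monoʳ-< 2 i<m))
    where e = (m + m) + (m + m) * (m + m)

  top-exponent≡N+ : ∀ {m i} → m ≤ i → (m + m) + (m + m) * (m + m) + 2 * i ≡ (m + m) + (m + m) * suc (m + m) + 2 * (i ∸ m)
  top-exponent≡N+ {m} {i} m≤i = begin
    e + 2 * i                   ≡⟨ cong (λ j → e + 2 * j) (m+[n∸m]≡n m≤i) ⟨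
    e + 2 * (m + (i ∸ m))       ≡⟨ cong (e +_) (*-distribˡ-+ 2 m (i ∸ m)) ⟩
    e + (2 * m + 2 * (i ∸ m))   ≡⟨ +-assoc e (2 * m) (2 * (i ∸ m)) ⟨
    e + 2 * m + 2 * (i ∸ m)     ≡⟨ cong (_+ 2 * (i ∸ m)) (top-exponent≡N m) ⟩
    (m + m) + (m + m) * suc (m + m) + 2 * (i ∸ m) ∎
    where
    open ≡-Reasoning
    e = (m + m) + (m + m) * (m + m)

  n<n+n*[1+n] : ∀ {n} → 0 < n + n * suc n → n < n + n * suc n
  n<n+n*[1+n] {suc n} _ = m<m+n (suc n) z<s

module Characteristic {c ℓ} (R : Ring c ℓ) where
  open Ring R
  open Arithmetic using (p∣p^kC[1+j])
  open import Algebra.Properties.Monoid.Mult +-monoid using (_×_; ×-homo-+)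
  open import Algebra.Properties.Semiring.Mult semiring using (×1-homo-*)
  open import Algebra.Properties.Semiring.Exp semiring using (_^_)
  open import Algebra.Properties.Ring R using (-1*x≈-x)
  open import Algebra.Properties.Group +-group using (inverseʳ-unique)
  open import Relation.Binary.Reasoning.Setoid setoid

  ×1-homo-^ : ∀ n k → (n ℕ.^ k) × 1# ≈ (n × 1#) ^ k
  ×1-homo-^ n zero    = +-identityʳ 1#
  ×1-homo-^ n (suc k) = trans (×1-homo-* n (n ℕ.^ k)) (*-congˡ (×1-homo-^ n k))

  module _ {p} (p-prime : Prime p) (p×1≈0 : p × 1# ≈ 0#) where

    p∣n⇒n×1≈0 : ∀ {n} → p ∣ n → n × 1# ≈ 0#
    p∣n⇒n×1≈0 (divides d ≡.refl) = begin
      (d ℕ.* p) × 1#       ≈⟨ ×1-homo-* d p ⟩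
      (d × 1#) * (p × 1#)  ≈⟨ *-congˡ p×1≈0 ⟩
      (d × 1#) * 0#        ≈⟨ zeroʳ _ ⟩
      0#                   ∎

    [p^k-1]Cj×1≈[-1]^j : ∀ {k r j} → suc r ≡ p ℕ.^ k → j ℕ.≤ r → (r C j) × 1# ≈ (- 1#) ^ j
    [p^k-1]Cj×1≈[-1]^j {j = zero}  _      _     = +-identityʳ 1#
    [p^k-1]Cj×1≈[-1]^j {k} {r} {suc j} q≡p^k 1+j≤r = begin
      (r C suc j) × 1#      ≈⟨ inverseʳ-unique _ _ rCj+rC[1+j]≈0 ⟩
      - ((r C j) × 1#)      ≈⟨ -‿cong ([p^k-1]Cj×1≈[-1]^j {k} q≡p^k (ℕ.<⇒≤ 1+j≤r)) ⟩
      - ((- 1#) ^ j)        ≈⟨ -1*x≈-x _ ⟨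
      (- 1#) ^ suc j        ∎
      where
      rCj+rC[1+j]≈0 : (r C j) × 1# + (r C suc j) × 1# ≈ 0#
      rCj+rC[1+j]≈0 = begin
        (r C j) × 1# + (r C suc j) × 1#  ≈⟨ ×-homo-+ 1# (r C j) (r C suc j) ⟨
        (r C j ℕ.+ r C suc j) × 1#       ≡⟨ ≡.cong (_× 1#) (nCk+nC[k+1]≡[n+1]C[k+1] r j) ⟩
        (suc r C suc j) × 1#             ≈⟨ p∣n⇒n×1≈0 (p∣p^kC[1+j] {k = k} p-prime q≡p^k (ℕ.s≤s 1+j≤r)) ⟩
        0#                               ∎

module IndexedSum {c ℓ} (M : Monoid c ℓ) where
  open Monoid M
  open import Algebra.Properties.Monoid.Sum M using (sum)

  ∑-zero : ∀ n (f : ℕ → Carrier) → (∀ i → i < n → f i ≈ ε) → sum {n} (f ∘ toℕ) ≈ ε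
  ∑-zero zero    f _   = refl
  ∑-zero (suc n) f f≈ε = trans (∙-cong (f≈ε 0 z<s) (∑-zero n (f ∘ suc) (λ i i<n → f≈ε (suc i) (s<s i<n)))) (identityˡ ε)

  ∑-single : ∀ n (f : ℕ → Carrier) {k} → k < n → (∀ i → i < n → i ≢ k → f i ≈ ε) → sum {n} (f ∘ toℕ) ≈ f k
  ∑-single (suc n) f {zero}  _           f≈ε =
    trans (∙-congˡ (∑-zero n (f ∘ suc) (λ i i<n → f≈ε (suc i) (s<s i<n) λ ()))) (identityʳ (f 0))
  ∑-single (suc n) f {suc k} (s<s k<n) f≈ε =
    trans (∙-cong (f≈ε 0 z<s λ ())
                  (∑-single n (f ∘ suc) k<n λ i i<n i≢k → f≈ε (suc i) (s<s i<n) (i≢k ∘ ℕ.suc-injective)))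
          (identityˡ (f (suc k)))

module BinomialSum {c ℓ} (R : CommutativeSemiring c ℓ) where
  open CommutativeSemiring R
  open import Algebra.Properties.Semiring.Exp semiring using (_^_)
  open import Algebra.Properties.Semiring.Mult semiring using (×-comm-*; ×-assoc-*)
  open import Algebra.Properties.Monoid.Mult +-monoid using (_×_; ×-congʳ)
  open import Algebra.Properties.Semiring.Sum semiring using (sum; sum-cong-≋; ∑-comm; *-distribˡ-sum)
  open import Algebra.Properties.CommutativeSemiring.Binomial R using (theorem)
  open import Relation.Binary.Reasoning.Setoid setoid

  ∑-binomial : ∀ {n} (g u v : Fin n → Carrier) s →
               sum (λ j → g j * (u j + v j) ^ s) ≈
               sum {suc s} (λ i → (s C toℕ i) × 1# * sum (λ j → g j * (u j ^ toℕ i * v j ^ (s ∸ toℕ i))))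
  ∑-binomial {n} g u v s = begin
    sum (λ j → g j * (u j + v j) ^ s)
      ≈⟨ sum-cong-≋ {n} (λ j → *-congˡ (theorem s (u j) (v j))) ⟩
    sum (λ j → g j * sum {suc s} (λ i → (s C toℕ i) × term j i))
      ≈⟨ sum-cong-≋ {n} (λ j → *-distribˡ-sum {suc s} (g j) (λ i → (s C toℕ i) × term j i)) ⟩
    sum (λ j → sum {suc s} (λ i → g j * ((s C toℕ i) × term j i)))
      ≈⟨ sum-cong-≋ {n} (λ j → sum-cong-≋ {suc s} (λ i → ×-pull (s C toℕ i) (g j) (term j i))) ⟩
    sum (λ j → sum {suc s} (λ i → (s C toℕ i) × 1# * (g j * term j i)))
      ≈⟨ ∑-comm {n} {suc s} (λ j i → (s C toℕ i) × 1# * (g j * term j i)) ⟩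
    sum {suc s} (λ i → sum (λ j → (s C toℕ i) × 1# * (g j * term j i)))
      ≈⟨ sum-cong-≋ {suc s} (λ i → sym (*-distribˡ-sum ((s C toℕ i) × 1#) (λ j → g j * term j i))) ⟩
    sum {suc s} (λ i → (s C toℕ i) × 1# * sum (λ j → g j * term j i))
      ∎
    where
    term : Fin n → Fin (suc s) → Carrier
    term j i = u j ^ toℕ i * v j ^ (s ∸ toℕ i)
    ×-pull : ∀ k x y → x * (k × y) ≈ k × 1# * (x * y)
    ×-pull k x y = begin
      x * (k × y)         ≈⟨ ×-comm-* k x y ⟩
      k × (x * y)         ≈⟨ ×-congʳ k (*-identityˡ (x * y)) ⟨
      k × (1# * (x * y))  ≈⟨ ×-assoc-* k 1# (x * y) ⟨
      k × 1# * (x * y)    ∎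

module FieldProperties {c ℓ} (F : CommutativeRing c ℓ) (isField : IsField F) where
  open CommutativeRing F hiding (zero)
  open IsField isField
  open import Algebra.Properties.Ring ring using ([y-z]x≈yx-zx; x[y-z]≈xy-xz)
  open import Algebra.Properties.Semiring.Exp semiring using (_^_)
  open import Algebra.Properties.Group +-group
    using (x∙y⁻¹≈ε⇒x≈y; x≈y⇒x∙y⁻¹≈ε; ⁻¹-involutive; ε⁻¹≈ε; ⁻¹-anti-homo-∙)
  open import Algebra.Properties.CommutativeSemigroup +-commutativeSemigroup using (interchange)
  open import Algebra.Properties.CommutativeSemigroup *-commutativeSemigroup using (x∙yz≈y∙xz)
  private module ∏ = Sum *-commutativeMonoid
  open import Relation.Binary.Reasoning.Setoid setoid

  x≉0∧x*y≈0⇒y≈0 : ∀ {x y} → ¬ x ≈ 0# → x * y ≈ 0# → y ≈ 0#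
  x≉0∧x*y≈0⇒y≈0 {x} {y} x≉0 xy≈0 with inverse x x≉0
  ... | x⁻¹ , xx⁻¹≈1 = begin
    y               ≈⟨ *-identityˡ y ⟨
    1# * y          ≈⟨ *-congʳ (trans (sym xx⁻¹≈1) (*-comm x x⁻¹)) ⟩
    (x⁻¹ * x) * y   ≈⟨ *-assoc x⁻¹ x y ⟩
    x⁻¹ * (x * y)   ≈⟨ *-congˡ xy≈0 ⟩
    x⁻¹ * 0#        ≈⟨ zeroʳ x⁻¹ ⟩
    0#              ∎

  y≉0∧x*y≈0⇒x≈0 : ∀ {x y} → ¬ y ≈ 0# → x * y ≈ 0# → x ≈ 0#
  y≉0∧x*y≈0⇒x≈0 {x} {y} y≉0 xy≈0 = x≉0∧x*y≈0⇒y≈0 y≉0 (trans (*-comm y x) xy≈0)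

  x≉0∧y≉0⇒x*y≉0 : ∀ {x y} → ¬ x ≈ 0# → ¬ y ≈ 0# → ¬ x * y ≈ 0#
  x≉0∧y≉0⇒x*y≉0 x≉0 y≉0 = y≉0 ∘ x≉0∧x*y≈0⇒y≈0 x≉0

  x≉0⇒x^n≉0 : ∀ {x} n → ¬ x ≈ 0# → ¬ x ^ n ≈ 0#
  x≉0⇒x^n≉0 zero    _   = 0≉1 ∘ sym
  x≉0⇒x^n≉0 (suc n) x≉0 = x≉0∧y≉0⇒x*y≉0 x≉0 (x≉0⇒x^n≉0 n x≉0)

  ∏≉0 : ∀ {n} (f : Fin n → Carrier) → (∀ i → ¬ f i ≈ 0#) → ¬ ∏.sum f ≈ 0#
  ∏≉0 {zero}  f f≉0 = 0≉1 ∘ sym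
  ∏≉0 {suc n} f f≉0 = x≉0∧y≉0⇒x*y≉0 (f≉0 Fin.zero) (∏≉0 (f ∘ Fin.suc) (f≉0 ∘ Fin.suc))

  -1≉0 : ¬ - 1# ≈ 0#
  -1≉0 -1≈0 = 0≉1 (sym (trans (sym (⁻¹-involutive 1#)) (trans (-‿cong -1≈0) ε⁻¹≈ε)))

  [x-1]*y≈0 : ∀ {x y} → x * y ≈ y → (x - 1#) * y ≈ 0#
  [x-1]*y≈0 {x} {y} xy≈y = begin
    (x - 1#) * y     ≈⟨ [y-z]x≈yx-zx y x 1# ⟩
    x * y - 1# * y   ≈⟨ x≈y⇒x∙y⁻¹≈ε (trans xy≈y (sym (*-identityˡ y))) ⟩
    0#               ∎

  x*y≈y∧y≉0⇒x≈1 : ∀ {x y} → x * y ≈ y → ¬ y ≈ 0# → x ≈ 1#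
  x*y≈y∧y≉0⇒x≈1 {x} xy≈y y≉0 = x∙y⁻¹≈ε⇒x≈y x 1# (y≉0∧x*y≈0⇒x≈0 y≉0 ([x-1]*y≈0 xy≈y))

  x*y≈y∧x≉1⇒y≈0 : ∀ {x y} → x * y ≈ y → ¬ x ≈ 1# → y ≈ 0#
  x*y≈y∧x≉1⇒y≈0 {x} xy≈y x≉1 = x≉0∧x*y≈0⇒y≈0 (x≉1 ∘ x∙y⁻¹≈ε⇒x≈y x 1#) ([x-1]*y≈0 xy≈y)

  [a+u]-[a+v]≈u-v : ∀ a u v → (a + u) - (a + v) ≈ u - v
  [a+u]-[a+v]≈u-v a u v = begin
    (a + u) - (a + v)        ≈⟨ +-congˡ (⁻¹-anti-homo-∙ a v) ⟩
    (a + u) + (- v + - a)    ≈⟨ +-congˡ (+-comm (- v) (- a)) ⟩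
    (a + u) + (- a + - v)    ≈⟨ interchange a u (- a) (- v) ⟩
    (a - a) + (u - v)        ≈⟨ +-congʳ (-‿inverseʳ a) ⟩
    0# + (u - v)             ≈⟨ +-identityˡ (u - v) ⟩
    u - v                    ∎

  [u-v]+[v-w]≈u-w : ∀ u v w → (u - v) + (v - w) ≈ u - w
  [u-v]+[v-w]≈u-w u v w = begin
    (u - v) + (v - w)        ≈⟨ +-assoc u (- v) (v - w) ⟩
    u + (- v + (v - w))      ≈⟨ +-congˡ (+-assoc (- v) v (- w)) ⟨
    u + ((- v + v) - w)      ≈⟨ +-congˡ (+-congʳ (-‿inverseˡ v)) ⟩
    u + (0# - w)             ≈⟨ +-congˡ (+-identityˡ (- w)) ⟩
    u - w                    ∎

  -- monic (a₀ ∷ ⋯ ∷ a_{d-1}) x = a₀ + a₁ x + ⋯ + a_{d-1} x^(d-1) + x^d, in Horner form.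
  monic : ∀ {d} → Vec Carrier d → Carrier → Carrier
  monic []       x = 1#
  monic (a ∷ as) x = a + x * monic as x

  monic-replicate-0 : ∀ d x → monic (replicate d 0#) x ≈ x ^ d
  monic-replicate-0 zero    x = refl
  monic-replicate-0 (suc d) x = trans (+-identityˡ _) (*-congˡ (monic-replicate-0 d x))

  monic-factor : ∀ {d} (P : Vec Carrier (suc d)) a →
                 Σ[ Q ∈ Vec Carrier d ] ∀ x → monic P x - monic P a ≈ (x - a) * monic Q x
  monic-factor {zero}  (b ∷ []) a = [] , λ x → begin
    (b + x * 1#) - (b + a * 1#)  ≈⟨ [a+u]-[a+v]≈u-v b (x * 1#) (a * 1#) ⟩
    x * 1# - a * 1#              ≈⟨ [y-z]x≈yx-zx 1# x a ⟨
    (x - a) * 1#                 ∎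
  monic-factor {suc d} (b ∷ P) a with monic-factor P a
  ... | Q , P-factor = monic P a ∷ Q , λ x → begin
    (b + x * monic P x) - (b + a * monic P a)               ≈⟨ [a+u]-[a+v]≈u-v b _ _ ⟩
    x * monic P x - a * monic P a                          ≈⟨ [u-v]+[v-w]≈u-w _ (x * monic P a) _ ⟨
    (x * monic P x - x * monic P a) + (x * monic P a - a * monic P a)
                                                           ≈⟨ +-cong (x[y-z]≈xy-xz x _ _) ([y-z]x≈yx-zx (monic P a) x a) ⟨
    x * (monic P x - monic P a) + (x - a) * monic P a      ≈⟨ +-comm _ _ ⟩
    (x - a) * monic P a + x * (monic P x - monic P a)      ≈⟨ +-congˡ (*-congˡ (P-factor x)) ⟩
    (x - a) * monic P a + x * ((x - a) * monic Q x)        ≈⟨ +-congˡ (x∙yz≈y∙xz x (x - a) (monic Q x)) ⟩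
    (x - a) * monic P a + (x - a) * (x * monic Q x)        ≈⟨ distribˡ (x - a) _ _ ⟨
    (x - a) * (monic P a + x * monic Q x)                  ∎

  monic-root-bound : ∀ {d} (P : Vec Carrier d) (r : Fin (suc d) → Carrier) →
                     Injective _≡_ _≈_ r → ¬ (∀ i → monic P (r i) ≈ 0#)
  monic-root-bound []      r _           roots = 0≉1 (sym (roots Fin.zero))
  monic-root-bound (b ∷ P) r r-injective roots with monic-factor (b ∷ P) (r Fin.zero)
  ... | Q , factor = monic-root-bound Q (r ∘ Fin.suc) (suc-injective ∘ r-injective) Q-roots
    where
    Q-roots : ∀ i → monic Q (r (Fin.suc i)) ≈ 0#
    Q-roots i = x≉0∧x*y≈0⇒y≈0 (0≢1+n ∘ ≡.sym ∘ r-injective ∘ x∙y⁻¹≈ε⇒x≈y _ _) (begin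
      (r (Fin.suc i) - r Fin.zero) * monic Q (r (Fin.suc i))      ≈⟨ factor (r (Fin.suc i)) ⟨
      monic (b ∷ P) (r (Fin.suc i)) - monic (b ∷ P) (r Fin.zero)  ≈⟨ +-cong (roots (Fin.suc i)) (-‿cong (roots Fin.zero)) ⟩
      0# - 0#                                                     ≈⟨ -‿inverseʳ 0# ⟩
      0#                                                          ∎)

module FiniteField {c ℓ} (F : CommutativeRing c ℓ) (isField : IsField F) {N : ℕ} (card : HasCard F (suc N)) where
  open CommutativeRing F hiding (zero)
  open IsField isField
  open FieldProperties F isField
  open Characteristic ring using (×1-homo-^)
  open Inverse card public using () renaming (to to enum)
  open Inverse card using (from; from-cong; strictlyInverseˡ; strictlyInverseʳ)
  open import Algebra.Properties.Semiring.Exp semiring using (_^_; ^-congˡ; ^-homo-*)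
  open import Algebra.Properties.CommutativeSemiring.Exp commutativeSemiring using (^-distrib-*)
  open import Algebra.Properties.Monoid.Mult +-monoid using (_×_)
  open import Algebra.Properties.Group +-group using (identityʳ-unique; inverseʳ-unique)
  open import Algebra.Properties.Semiring.Sum semiring using (*-distribˡ-sum)
  open import Relation.Binary.Reasoning.Setoid setoid
  module ∑ = Sum +-commutativeMonoid
  module ∏ = Sum *-commutativeMonoid

  from-injective : ∀ {x y} → from x ≡ from y → x ≈ y
  from-injective {x} {y} eq = trans (sym (strictlyInverseˡ x)) (trans (reflexive (≡.cong enum eq)) (strictlyInverseˡ y))

  infix 4 _≈?_
  _≈?_ : Decidable _≈_
  x ≈? y = map′ from-injective from-cong (from x Fin.≟ from y)

  0<N : 0 < N
  0<N = ℕ.n≢0⇒n>0 λ N≡0 → 0≉1 (from-injective (Fin[1+n]-trivial N≡0 (from 0#) (from 1#)))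
    where
    Fin[1+n]-trivial : ∀ {n} → n ≡ 0 → (i j : Fin (suc n)) → i ≡ j
    Fin[1+n]-trivial ≡.refl Fin.zero Fin.zero = ≡.refl

  nonzero : Fin N → Carrier
  nonzero j = enum (punchIn (from 0#) j)

  nonzero≉0 : ∀ j → ¬ nonzero j ≈ 0#
  nonzero≉0 j nonzero≈0 = punchInᵢ≢i (from 0#) j (≡.trans (≡.sym (strictlyInverseʳ _)) (from-cong nonzero≈0))

  nonzero-injective : Injective _≡_ _≈_ nonzero
  nonzero-injective {i} {j} eq = punchIn-injective (from 0#) i j
    (≡.trans (≡.sym (strictlyInverseʳ _)) (≡.trans (from-cong eq) (strictlyInverseʳ _)))

  module Summation {m ℓm} (M : CommutativeMonoid m ℓm) where
    open CommutativeMonoid M using (_∙_; ∙-congʳ) renaming (Carrier to A; _≈_ to _≈ᴹ_; trans to transᴹ; sym to symᴹ)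
    open Sum M using (sum; ∑-permute; sum-remove; sum-cong-≋)

    ∑ᶠ : (Carrier → A) → A
    ∑ᶠ g = sum (g ∘ enum)

    ∑ᶠ-cong : ∀ {g h} → (∀ x → g x ≈ᴹ h x) → ∑ᶠ g ≈ᴹ ∑ᶠ h
    ∑ᶠ-cong g≈h = sum-cong-≋ {suc N} (g≈h ∘ enum)

    ∑ᶠ-invariant : (π : Inverse setoid setoid) → ∀ {g} → Congruent _≈_ _≈ᴹ_ g → ∑ᶠ (g ∘ Inverse.to π) ≈ᴹ ∑ᶠ g
    ∑ᶠ-invariant π {g} g-cong =
      symᴹ (transᴹ (∑-permute (g ∘ enum) σ) (sum-cong-≋ {suc N} λ i → g-cong (strictlyInverseˡ (Inverse.to π (enum i)))))
      where
      σ : Permutation (suc N) (suc N)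
      σ = Composition.inverse (Composition.inverse card π) (Symmetry.inverse card)

    ∑ᶠ-split-zero : ∀ {g} → Congruent _≈_ _≈ᴹ_ g → ∑ᶠ g ≈ᴹ g 0# ∙ sum (g ∘ nonzero)
    ∑ᶠ-split-zero {g} g-cong = transᴹ (sum-remove {i = from 0#} (g ∘ enum))
      (∙-congʳ (g-cong (strictlyInverseˡ 0#)))

  open Summation +-commutativeMonoid public
  open Summation *-commutativeMonoid public using ()
    renaming (∑ᶠ to ∏ᶠ; ∑ᶠ-invariant to ∏ᶠ-invariant; ∑ᶠ-split-zero to ∏ᶠ-split-zero)

  permutation : ∀ {h h′} → Congruent _≈_ _≈_ h → Congruent _≈_ _≈_ h′ →
                (∀ y → h (h′ y) ≈ y) → (∀ x → h′ (h x) ≈ x) → Inverse setoid setoid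
  permutation {h} {h′} h-cong h′-cong hh′ h′h = record
    { to        = h
    ; from      = h′
    ; to-cong   = h-cong
    ; from-cong = h′-cong
    ; inverse   = (λ {x} y≈h′x → trans (h-cong y≈h′x) (hh′ x)) , (λ {x} y≈hx → trans (h′-cong y≈hx) (h′h x))
    }

  +1-permutation : Inverse setoid setoid
  +1-permutation = permutation {_+ 1#} {_- 1#} +-congʳ +-congʳ
    (λ y → trans (+-assoc y (- 1#) 1#) (trans (+-congˡ (-‿inverseˡ 1#)) (+-identityʳ y)))
    (λ x → trans (+-assoc x 1# (- 1#)) (trans (+-congˡ (-‿inverseʳ 1#)) (+-identityʳ x)))

  *-permutation : ∀ {a} → ¬ a ≈ 0# → Inverse setoid setoid
  *-permutation {a} a≉0 = permutation {a *_} {a⁻¹ *_} *-congˡ *-congˡ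
    (λ y → trans (sym (*-assoc a a⁻¹ y)) (trans (*-congʳ aa⁻¹≈1) (*-identityˡ y)))
    (λ x → trans (sym (*-assoc a⁻¹ a x)) (trans (*-congʳ (trans (*-comm a⁻¹ a) aa⁻¹≈1)) (*-identityˡ x)))
    where
    a⁻¹ = proj₁ (inverse a a≉0)
    aa⁻¹≈1 = proj₂ (inverse a a≉0)

  card×1≈0 : suc N × 1# ≈ 0#
  card×1≈0 = identityʳ-unique (∑ᶠ id) (suc N × 1#) (begin
    ∑ᶠ id + suc N × 1#         ≈⟨ +-congˡ (∑.sum-replicate (suc N)) ⟨
    ∑ᶠ id + ∑ᶠ (λ _ → 1#)      ≈⟨ ∑.∑-distrib-+ enum (λ _ → 1#) ⟨
    ∑ᶠ (_+ 1#)                 ≈⟨ ∑ᶠ-invariant +1-permutation id ⟩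
    ∑ᶠ id                      ∎)

  -- Replacing 0 by 1 keeps ∏ₓ x⁺ nonzero; comparing it with ∏ₓ (a x)⁺ gives a^N = 1.
  _⁺ : Carrier → Carrier
  x ⁺ with x ≈? 0#
  ... | yes _ = 1#
  ... | no  _ = x

  ⁺-cong : Congruent _≈_ _≈_ _⁺
  ⁺-cong {x} {y} x≈y with x ≈? 0# | y ≈? 0#
  ... | yes _   | yes _   = refl
  ... | yes x≈0 | no  y≉0 = contradiction (trans (sym x≈y) x≈0) y≉0
  ... | no  x≉0 | yes y≈0 = contradiction (trans x≈y y≈0) x≉0
  ... | no  _   | no  _   = x≈y

  x≈0⇒x⁺≈1 : ∀ {x} → x ≈ 0# → x ⁺ ≈ 1#
  x≈0⇒x⁺≈1 {x} x≈0 with x ≈? 0#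
  ... | yes _   = refl
  ... | no  x≉0 = contradiction x≈0 x≉0

  x≉0⇒x⁺≈x : ∀ {x} → ¬ x ≈ 0# → x ⁺ ≈ x
  x≉0⇒x⁺≈x {x} x≉0 with x ≈? 0#
  ... | yes x≈0 = contradiction x≈0 x≉0
  ... | no  _   = refl

  ∏ᶠ⁺≈∏nonzero : ∀ {g} → Congruent _≈_ _≈_ g → g 0# ≈ 0# → (∀ j → ¬ g (nonzero j) ≈ 0#) →
                 ∏ᶠ (λ x → g x ⁺) ≈ ∏.sum (g ∘ nonzero)
  ∏ᶠ⁺≈∏nonzero {g} g-cong g0≈0 g≉0 = begin
    ∏ᶠ (λ x → g x ⁺)                              ≈⟨ ∏ᶠ-split-zero (⁺-cong ∘ g-cong) ⟩
    g 0# ⁺ * ∏.sum (λ j → g (nonzero j) ⁺)        ≈⟨ *-cong (x≈0⇒x⁺≈1 g0≈0) (∏.sum-cong-≋ {N} (x≉0⇒x⁺≈x ∘ g≉0)) ⟩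
    1# * ∏.sum (g ∘ nonzero)                      ≈⟨ *-identityˡ _ ⟩
    ∏.sum (g ∘ nonzero)                           ∎

  x^N≈1 : ∀ {a} → ¬ a ≈ 0# → a ^ N ≈ 1#
  x^N≈1 {a} a≉0 = x*y≈y∧y≉0⇒x≈1 (begin
    a ^ N * ∏.sum nonzero                ≈⟨ *-congʳ (∏.sum-replicate N) ⟨
    ∏.sum {N} (λ _ → a) * ∏.sum nonzero  ≈⟨ ∏.∑-distrib-+ (λ _ → a) nonzero ⟨
    ∏.sum (λ j → a * nonzero j)          ≈⟨ ∏ᶠ⁺≈∏nonzero *-congˡ (zeroʳ a) (x≉0∧y≉0⇒x*y≉0 a≉0 ∘ nonzero≉0) ⟨
    ∏ᶠ (λ x → (a * x) ⁺)                 ≈⟨ ∏ᶠ-invariant (*-permutation a≉0) ⁺-cong ⟩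
    ∏ᶠ _⁺                                ≈⟨ ∏ᶠ⁺≈∏nonzero id refl nonzero≉0 ⟩
    ∏.sum nonzero                        ∎) (∏≉0 nonzero nonzero≉0)

  x^n≈0⇒x≈0 : ∀ {x} n → x ^ n ≈ 0# → x ≈ 0#
  x^n≈0⇒x≈0 {x} n x^n≈0 = decidable-stable (x ≈? 0#) λ x≉0 → x≉0⇒x^n≉0 n x≉0 x^n≈0

  card≡p^k⇒p×1≈0 : ∀ {p k} → suc N ≡ p ℕ.^ k → p × 1# ≈ 0#
  card≡p^k⇒p×1≈0 {p} {k} card≡p^k = x^n≈0⇒x≈0 k (begin
    (p × 1#) ^ k      ≈⟨ ×1-homo-^ p k ⟨
    (p ℕ.^ k) × 1#    ≡⟨ ≡.cong (_× 1#) card≡p^k ⟨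
    suc N × 1#        ≈⟨ card×1≈0 ⟩
    0#                ∎)

  -- - 1# ∷ replicate e 0# is X^(e+1) − 1, which has no e + 2 distinct roots.
  ∃x^[1+e]≉1 : ∀ {e} → suc e < N → ∃[ j ] ¬ nonzero j ^ suc e ≈ 1#
  ∃x^[1+e]≉1 {e} 1+e<N = ¬∀⟶∃¬ N _ (λ j → nonzero j ^ suc e ≈? 1#) λ all-roots →
    monic-root-bound (- 1# ∷ replicate e 0#) (nonzero ∘ inject) (inject-injective ∘ nonzero-injective)
      (λ i → x^[1+e]≈1⇒root (all-roots (inject i)))
    where
    inject : Fin (suc (suc e)) → Fin N
    inject i = Fin.inject≤ i 1+e<N
    inject-injective : Injective _≡_ _≡_ inject
    inject-injective = inject≤-injective 1+e<N 1+e<N _ _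
    x^[1+e]≈1⇒root : ∀ {x} → x ^ suc e ≈ 1# → monic (- 1# ∷ replicate e 0#) x ≈ 0#
    x^[1+e]≈1⇒root {x} x^[1+e]≈1 = begin
      - 1# + x * monic (replicate e 0#) x    ≈⟨ +-congˡ (*-congˡ (monic-replicate-0 e x)) ⟩
      - 1# + x ^ suc e                      ≈⟨ +-congˡ x^[1+e]≈1 ⟩
      - 1# + 1#                             ≈⟨ -‿inverseˡ 1# ⟩
      0#                                    ∎

  ∑x^e≈0 : ∀ {e} → e < N → ∑ᶠ (_^ e) ≈ 0#
  ∑x^e≈0 {zero}  _     = trans (∑.sum-replicate (suc N)) card×1≈0
  ∑x^e≈0 {suc e} 1+e<N with ∃x^[1+e]≉1 1+e<N
  ... | j , a^[1+e]≉1 = x*y≈y∧x≉1⇒y≈0 (begin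
    a ^ suc e * ∑ᶠ (_^ suc e)              ≈⟨ *-distribˡ-sum (a ^ suc e) (λ i → enum i ^ suc e) ⟩
    ∑ᶠ (λ x → a ^ suc e * x ^ suc e)        ≈⟨ ∑ᶠ-cong (λ x → ^-distrib-* a x (suc e)) ⟨
    ∑ᶠ (λ x → (a * x) ^ suc e)              ≈⟨ ∑ᶠ-invariant (*-permutation (nonzero≉0 j)) (^-congˡ (suc e)) ⟩
    ∑ᶠ (_^ suc e)                           ∎) a^[1+e]≉1
    where a = nonzero j

  ∑x^e≈∑nonzero^e : ∀ {e} → 0 < e → ∑ᶠ (_^ e) ≈ ∑.sum (λ j → nonzero j ^ e)
  ∑x^e≈∑nonzero^e {suc e} _ = trans (∑ᶠ-split-zero (^-congˡ (suc e))) (trans (+-congʳ (zeroˡ _)) (+-identityˡ _))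

  ∑x^N≈-1 : ∑ᶠ (_^ N) ≈ - 1#
  ∑x^N≈-1 = begin
    ∑ᶠ (_^ N)                        ≈⟨ ∑x^e≈∑nonzero^e 0<N ⟩
    ∑.sum (λ j → nonzero j ^ N)      ≈⟨ ∑.sum-cong-≋ {N} (x^N≈1 ∘ nonzero≉0) ⟩
    ∑.sum {N} (λ _ → 1#)             ≈⟨ ∑.sum-replicate N ⟩
    N × 1#                           ≈⟨ inverseʳ-unique 1# (N × 1#) card×1≈0 ⟩
    - 1#                             ∎

  ∑x^[N+e]≈∑x^e : ∀ {e} → 0 < e → ∑ᶠ (_^ (N ℕ.+ e)) ≈ ∑ᶠ (_^ e)
  ∑x^[N+e]≈∑x^e {e} 0<e = begin
    ∑ᶠ (_^ (N ℕ.+ e))                    ≈⟨ ∑x^e≈∑nonzero^e (ℕ.≤-trans 0<e (ℕ.m≤n+m e N)) ⟩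
    ∑.sum (λ j → nonzero j ^ (N ℕ.+ e))  ≈⟨ ∑.sum-cong-≋ {N} x^[N+e]≈x^e ⟩
    ∑.sum (λ j → nonzero j ^ e)          ≈⟨ ∑x^e≈∑nonzero^e 0<e ⟨
    ∑ᶠ (_^ e)                            ∎
    where
    x^[N+e]≈x^e : ∀ j → nonzero j ^ (N ℕ.+ e) ≈ nonzero j ^ e
    x^[N+e]≈x^e j = trans (^-homo-* _ N e) (trans (*-congʳ (x^N≈1 (nonzero≉0 j))) (*-identityˡ _))

module PermutationPolynomial {c ℓ} (F : CommutativeRing c ℓ) (isField : IsField F) (m : ℕ)
  (card : HasCard F (suc (m ℕ.+ m) ℕ.* suc (m ℕ.+ m))) (b c : CommutativeRing.Carrier F) where

  w : ℕ
  w = m ℕ.+ m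

  -- q² − 1 for q = w + 1; suc N is q * q by definition.
  N : ℕ
  N = w ℕ.+ w ℕ.* suc w

  open CommutativeRing F hiding (zero)
  open FieldProperties F isField
  open FiniteField F isField {N} card
  open Arithmetic using (outer-exponent<N; top-exponent≡N; top-exponent<N; top-exponent≡N+; n<n+n*[1+n])
  open Characteristic ring using ([p^k-1]Cj×1≈[-1]^j)
  open IndexedSum +-monoid using (∑-zero; ∑-single)
  open BinomialSum commutativeSemiring using (∑-binomial)
  open import Algebra.Properties.Semiring.Exp semiring using (_^_; ^-congˡ; ^-homo-*; ^-assocʳ)
  open import Algebra.Properties.CommutativeSemiring.Exp commutativeSemiring using (^-distrib-*)
  open import Algebra.Properties.Monoid.Mult +-monoid using (_×_)
  open import Algebra.Properties.Semiring.Sum semiring using (sum; sum-cong-≋; *-distribˡ-sum)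
  open import Algebra.Properties.CommutativeSemigroup *-commutativeSemigroup using (x∙yz≈y∙xz)
  open import Relation.Binary.Reasoning.Setoid setoid

  f : Carrier → Carrier
  f = fPoly F (suc w) b c

  S : ℕ → Carrier
  S e = ∑ᶠ (_^ e)

  G : ℕ → ℕ → Carrier
  G A s = ∑ᶠ (λ x → x ^ A * (x ^ 2 + b) ^ s)

  f≈x*[x^w*[x²+b]+c] : ∀ x → f x ≈ x * (x ^ w * (x ^ 2 + b) + c)
  f≈x*[x^w*[x²+b]+c] x = begin
    x * x ^ (w ℕ.+ 2) + b * (x * x ^ w) + c * x
      ≈⟨ +-cong (+-cong (*-congˡ (^-homo-* x w 2)) (x∙yz≈y∙xz b x (x ^ w))) (*-comm c x) ⟩
    x * (x ^ w * x ^ 2) + x * (b * x ^ w) + x * c   ≈⟨ +-congʳ (distribˡ x _ _) ⟨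
    x * (x ^ w * x ^ 2 + b * x ^ w) + x * c         ≈⟨ distribˡ x _ c ⟨
    x * (x ^ w * x ^ 2 + b * x ^ w + c)             ≈⟨ *-congˡ (+-congʳ x^w*x²+bx^w≈x^w*[x²+b]) ⟩
    x * (x ^ w * (x ^ 2 + b) + c)                   ∎
    where
    x^w*x²+bx^w≈x^w*[x²+b] : x ^ w * x ^ 2 + b * x ^ w ≈ x ^ w * (x ^ 2 + b)
    x^w*x²+bx^w≈x^w*[x²+b] = trans (+-congˡ (*-comm b (x ^ w))) (sym (distribˡ (x ^ w) (x ^ 2) b))

  ∑f^w≈∑G : ∑ᶠ (λ x → f x ^ w) ≈
            sum {suc w} (λ s → (w C toℕ s) × 1# * (c ^ (w ∸ toℕ s) * G (w ℕ.+ w ℕ.* toℕ s) (toℕ s)))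
  ∑f^w≈∑G = begin
    ∑ᶠ (λ x → f x ^ w)
      ≈⟨ ∑ᶠ-cong (λ x → trans (^-congˡ w (f≈x*[x^w*[x²+b]+c] x)) (^-distrib-* x _ w)) ⟩
    ∑ᶠ (λ x → x ^ w * (x ^ w * (x ^ 2 + b) + c) ^ w)
      ≈⟨ ∑-binomial (λ j → enum j ^ w) (λ j → enum j ^ w * (enum j ^ 2 + b)) (λ _ → c) w ⟩
    sum {suc w} (λ s → (w C toℕ s) × 1# * ∑ᶠ (λ x → x ^ w * ((x ^ w * (x ^ 2 + b)) ^ toℕ s * c ^ (w ∸ toℕ s))))
      ≈⟨ sum-cong-≋ {suc w} (λ s → *-congˡ {(w C toℕ s) × 1#} (∑-term (toℕ s) (w ∸ toℕ s))) ⟩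
    sum {suc w} (λ s → (w C toℕ s) × 1# * (c ^ (w ∸ toℕ s) * G (w ℕ.+ w ℕ.* toℕ s) (toℕ s)))
      ∎
    where
    term : ∀ s t y → y ^ w * ((y ^ w * (y ^ 2 + b)) ^ s * c ^ t) ≈ c ^ t * (y ^ (w ℕ.+ w ℕ.* s) * (y ^ 2 + b) ^ s)
    term s t y = begin
      y ^ w * ((y ^ w * (y ^ 2 + b)) ^ s * c ^ t)        ≈⟨ *-congˡ (*-congʳ (^-distrib-* (y ^ w) (y ^ 2 + b) s)) ⟩
      y ^ w * (((y ^ w) ^ s * (y ^ 2 + b) ^ s) * c ^ t)  ≈⟨ *-congˡ (*-comm _ (c ^ t)) ⟩
      y ^ w * (c ^ t * ((y ^ w) ^ s * (y ^ 2 + b) ^ s))  ≈⟨ x∙yz≈y∙xz (y ^ w) (c ^ t) _ ⟩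
      c ^ t * (y ^ w * ((y ^ w) ^ s * (y ^ 2 + b) ^ s))  ≈⟨ *-congˡ (*-assoc (y ^ w) _ _) ⟨
      c ^ t * ((y ^ w * (y ^ w) ^ s) * (y ^ 2 + b) ^ s)  ≈⟨ *-congˡ (*-congʳ y^w*[y^w]^s≈y^[w+ws]) ⟩
      c ^ t * (y ^ (w ℕ.+ w ℕ.* s) * (y ^ 2 + b) ^ s)    ∎
      where
      y^w*[y^w]^s≈y^[w+ws] : y ^ w * (y ^ w) ^ s ≈ y ^ (w ℕ.+ w ℕ.* s)
      y^w*[y^w]^s≈y^[w+ws] = trans (*-congˡ (^-assocʳ y w s)) (sym (^-homo-* y w (w ℕ.* s)))
    ∑-term : ∀ s t → ∑ᶠ (λ y → y ^ w * ((y ^ w * (y ^ 2 + b)) ^ s * c ^ t)) ≈ c ^ t * G (w ℕ.+ w ℕ.* s) s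
    ∑-term s t = trans (∑ᶠ-cong (term s t)) (sym (*-distribˡ-sum (c ^ t) (λ j → enum j ^ (w ℕ.+ w ℕ.* s) * (enum j ^ 2 + b) ^ s)))

  G≈∑S : ∀ A s → G A s ≈ sum {suc s} (λ i → (s C toℕ i) × 1# * (b ^ (s ∸ toℕ i) * S (A ℕ.+ 2 ℕ.* toℕ i)))
  G≈∑S A s = begin
    G A s
      ≈⟨ ∑-binomial (λ j → enum j ^ A) (λ j → enum j ^ 2) (λ _ → b) s ⟩
    sum {suc s} (λ i → (s C toℕ i) × 1# * ∑ᶠ (λ y → y ^ A * ((y ^ 2) ^ toℕ i * b ^ (s ∸ toℕ i))))
      ≈⟨ sum-cong-≋ {suc s} (λ i → *-congˡ {(s C toℕ i) × 1#} (∑-term (toℕ i) (s ∸ toℕ i))) ⟩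
    sum {suc s} (λ i → (s C toℕ i) × 1# * (b ^ (s ∸ toℕ i) * S (A ℕ.+ 2 ℕ.* toℕ i)))
      ∎
    where
    term : ∀ i t y → y ^ A * ((y ^ 2) ^ i * b ^ t) ≈ b ^ t * y ^ (A ℕ.+ 2 ℕ.* i)
    term i t y = begin
      y ^ A * ((y ^ 2) ^ i * b ^ t)      ≈⟨ *-congˡ (*-comm _ (b ^ t)) ⟩
      y ^ A * (b ^ t * (y ^ 2) ^ i)      ≈⟨ x∙yz≈y∙xz (y ^ A) (b ^ t) _ ⟩
      b ^ t * (y ^ A * (y ^ 2) ^ i)      ≈⟨ *-congˡ (*-congˡ (^-assocʳ y 2 i)) ⟩
      b ^ t * (y ^ A * y ^ (2 ℕ.* i))    ≈⟨ *-congˡ (^-homo-* y A (2 ℕ.* i)) ⟨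
      b ^ t * y ^ (A ℕ.+ 2 ℕ.* i)        ∎
    ∑-term : ∀ i t → ∑ᶠ (λ y → y ^ A * ((y ^ 2) ^ i * b ^ t)) ≈ b ^ t * S (A ℕ.+ 2 ℕ.* i)
    ∑-term i t = trans (∑ᶠ-cong (term i t)) (sym (*-distribˡ-sum (b ^ t) (λ j → enum j ^ (A ℕ.+ 2 ℕ.* i))))

  w<N : w < N
  w<N = n<n+n*[1+n] 0<N

  x*[y*z]≈0 : ∀ x y {z} → z ≈ 0# → x * (y * z) ≈ 0#
  x*[y*z]≈0 x y z≈0 = trans (*-congˡ (trans (*-congˡ z≈0) (zeroʳ y))) (zeroʳ x)

  G-vanishes : ∀ {s} → s < w → G (w ℕ.+ w ℕ.* s) s ≈ 0#
  G-vanishes {s} s<w = trans (G≈∑S (w ℕ.+ w ℕ.* s) s) (∑-zero (suc s) term term≈0)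
    where
    term : ℕ → Carrier
    term i = (s C i) × 1# * (b ^ (s ∸ i) * S (w ℕ.+ w ℕ.* s ℕ.+ 2 ℕ.* i))
    term≈0 : ∀ i → i < suc s → term i ≈ 0#
    term≈0 i i<1+s = x*[y*z]≈0 _ _ (∑x^e≈0 (outer-exponent<N s<w (ℕ.s≤s⁻¹ i<1+s)))

  S-top-vanishes : ∀ {i} → i ≤ w → i ≢ m → S (w ℕ.+ w ℕ.* w ℕ.+ 2 ℕ.* i) ≈ 0#
  S-top-vanishes {i} i≤w i≢m with ℕ.<-cmp i m
  ... | tri< i<m _ _ = ∑x^e≈0 (top-exponent<N i<m)
  ... | tri≈ _ i≡m _ = contradiction i≡m i≢m
  ... | tri> _ _ m<i = begin
    S (w ℕ.+ w ℕ.* w ℕ.+ 2 ℕ.* i)   ≡⟨ ≡.cong S (top-exponent≡N+ (ℕ.<⇒≤ m<i)) ⟩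
    S (N ℕ.+ 2 ℕ.* (i ∸ m))         ≈⟨ ∑x^[N+e]≈∑x^e (ℕ.*-monoʳ-< 2 (ℕ.m<n⇒0<n∸m m<i)) ⟩
    S (2 ℕ.* (i ∸ m))               ≈⟨ ∑x^e≈0 (ℕ.≤-<-trans 2[i∸m]≤w w<N) ⟩
    0#                              ∎
    where
    2[i∸m]≤w : 2 ℕ.* (i ∸ m) ≤ w
    2[i∸m]≤w = ℕ.≤-trans (ℕ.*-monoʳ-≤ 2 (ℕ.m≤n+o⇒m∸n≤o i m i≤w))
                         (ℕ.≤-reflexive (≡.cong (m ℕ.+_) (ℕ.+-identityʳ m)))

  G-top : G (w ℕ.+ w ℕ.* w) w ≈ (w C m) × 1# * (b ^ m * - 1#)
  G-top = begin
    G (w ℕ.+ w ℕ.* w) w            ≈⟨ G≈∑S (w ℕ.+ w ℕ.* w) w ⟩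
    sum {suc w} (term ∘ toℕ)       ≈⟨ ∑-single (suc w) term (ℕ.s≤s (ℕ.m≤m+n m m)) term≈0 ⟩
    term m                         ≈⟨ *-congˡ (*-cong (reflexive (≡.cong (b ^_) (ℕ.m+n∸m≡n m m))) S-top) ⟩
    (w C m) × 1# * (b ^ m * - 1#)  ∎
    where
    term : ℕ → Carrier
    term i = (w C i) × 1# * (b ^ (w ∸ i) * S (w ℕ.+ w ℕ.* w ℕ.+ 2 ℕ.* i))
    term≈0 : ∀ i → i < suc w → i ≢ m → term i ≈ 0#
    term≈0 i i<1+w i≢m = x*[y*z]≈0 _ _ (S-top-vanishes (ℕ.s≤s⁻¹ i<1+w) i≢m)
    S-top : S (w ℕ.+ w ℕ.* w ℕ.+ 2 ℕ.* m) ≈ - 1#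
    S-top = trans (reflexive (≡.cong S (top-exponent≡N m))) ∑x^N≈-1

  ∑f^w≈[wCm]b^m*-1 : ∑ᶠ (λ x → f x ^ w) ≈ (w C m) × 1# * (b ^ m * - 1#)
  ∑f^w≈[wCm]b^m*-1 = begin
    ∑ᶠ (λ x → f x ^ w)               ≈⟨ ∑f^w≈∑G ⟩
    sum {suc w} (term ∘ toℕ)         ≈⟨ ∑-single (suc w) term (ℕ.n<1+n w) term≈0 ⟩
    term w                           ≈⟨ term-w ⟩
    G (w ℕ.+ w ℕ.* w) w              ≈⟨ G-top ⟩
    (w C m) × 1# * (b ^ m * - 1#)    ∎
    where
    term : ℕ → Carrier
    term s = (w C s) × 1# * (c ^ (w ∸ s) * G (w ℕ.+ w ℕ.* s) s)
    term≈0 : ∀ s → s < suc w → s ≢ w → term s ≈ 0#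
    term≈0 s s<1+w s≢w = x*[y*z]≈0 _ _ (G-vanishes (ℕ.≤∧≢⇒< (ℕ.s≤s⁻¹ s<1+w) s≢w))
    term-w : term w ≈ G (w ℕ.+ w ℕ.* w) w
    term-w = begin
      (w C w) × 1# * (c ^ (w ∸ w) * G (w ℕ.+ w ℕ.* w) w)
        ≡⟨ ≡.cong₂ (λ k e → k × 1# * (c ^ e * G (w ℕ.+ w ℕ.* w) w)) (nCn≡1 w) (ℕ.n∸n≡0 w) ⟩
      (1# + 0#) * (1# * G (w ℕ.+ w ℕ.* w) w)               ≈⟨ *-cong (+-identityʳ 1#) (*-identityˡ _) ⟩
      1# * G (w ℕ.+ w ℕ.* w) w                             ≈⟨ *-identityˡ _ ⟩
      G (w ℕ.+ w ℕ.* w) w                                  ∎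

  f-cong : ∀ {x y} → x ≈ y → f x ≈ f y
  f-cong x≈y = +-cong (+-cong (^-congˡ (suc w ℕ.+ 2) x≈y) (*-congˡ (^-congˡ (suc w) x≈y))) (*-congˡ x≈y)

  ¬permutes : ∀ {p k} → Prime p → suc w ≡ p ℕ.^ k → ¬ b ≈ 0# → ¬ Permutes F f
  ¬permutes {p} {k} p-prime q≡p^k b≉0 f-permutes =
    x≉0∧y≉0⇒x*y≉0 [wCm]×1≉0 (x≉0∧y≉0⇒x*y≉0 (x≉0⇒x^n≉0 m b≉0) -1≉0) (begin
      (w C m) × 1# * (b ^ m * - 1#)  ≈⟨ ∑f^w≈[wCm]b^m*-1 ⟨
      ∑ᶠ (λ x → f x ^ w)             ≈⟨ ∑ᶠ-invariant f-inverse (^-congˡ w) ⟩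
      ∑ᶠ (_^ w)                      ≈⟨ ∑x^e≈0 w<N ⟩
      0#                             ∎)
    where
    f-inverse : Inverse setoid setoid
    f-inverse = Bijection⇒Inverse record { to = f ; cong = f-cong ; bijective = f-permutes }
    p×1≈0 : p × 1# ≈ 0#
    p×1≈0 = card≡p^k⇒p×1≈0 {p} {k ℕ.+ k} (≡.trans (≡.cong₂ ℕ._*_ q≡p^k q≡p^k) (≡.sym (ℕ.^-distribˡ-+-* p k k)))
    [wCm]×1≉0 : ¬ (w C m) × 1# ≈ 0#
    [wCm]×1≉0 = x≉0⇒x^n≉0 m -1≉0 ∘ trans (sym ([p^k-1]Cj×1≈[-1]^j p-prime p×1≈0 {k} q≡p^k (ℕ.m≤m+n m m)))

open import Data.Nat using (_*_)

lemma2p5 : {c ℓ : Level} (q : ℕ) → IsPrimePower q → ¬ (2 ∣ q) →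
           (F : CommutativeRing c ℓ) → IsField F → HasCard F (q * q) →
           (b c : CommutativeRing.Carrier F) → ¬ (CommutativeRing._≈_ F b (CommutativeRing.0# F)) →
           ¬ Permutes F (fPoly F q b c)
lemma2p5 q (p , k , p-prime , _ , q≡p^k) q-odd F isField card b c b≉0 with Arithmetic.¬2∣⇒≡1+m+m q q-odd
... | m , ≡.refl = PermutationPolynomial.¬permutes F isField m card b c {k = k} p-prime q≡p^k b≉0
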